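{- There are infinitely many real quadratic fields $K$, and also infinitely many imaginary quadratic fields $K$, each containing an element $c$ for which the directed graph $G(f_c,K)$ contains a subgraph isomorphic to the graph of type 8(4).
   Context: For a number field $K$ and $c\in K$, let $f_c(z)=z^2+c$. $G(f_c,K)$ is the directed graph whose vertices are the elements $x\in K$ that are preperiodic for $f_c$ (i.e. have finite forward orbit), with a directed edge $x\to f_c(x)$. The graph of type 8(4) is the directed graph on 8 vertices $x_1,x_2,x_3,x_4,y_1,y_2,y_3,y_4$ with edges $x_1\to x_2\to x_3\to x_4\to x_1$ and $y_i\to x_i$ for $i=1,\dots,4$. -}

module Defs where

open import Data.Nat as ℕ using (ℕ; zero; suc)
open import Data.Nat.Divisibility as ℕD using ()
open import Data.Integer as ℤ using (ℤ; +_; ∣_∣)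
open import Data.Rational as ℚ using (ℚ; _/_)
open import Data.Product using (_×_; _,_; proj₁; proj₂; Σ; ∃; ∃-syntax)
open import Data.Fin using (Fin; zero; suc)
open import Relation.Binary.PropositionalEquality using (_≡_; _≢_)

SquareFree : ℤ → Set
SquareFree d = d ≢ + 0 × (∀ (n : ℕ) → (n ℕ.* n) ℕD.∣ ∣ d ∣ → n ≡ 1)

-- Quadratic fields are ℚ(√d) for d squarefree, d ≠ 0, 1.
-- Elements of ℚ(√d) are represented as a + b√d, i.e. pairs (a , b) of rationals
-- (a ℚ-basis representation; equality is componentwise equality).
QF : ℤ → Set
QF d = ℚ × ℚ

-- multiplication: (a + b√d)(a' + b'√d) = (aa' + d bb') + (ab' + a'b)√d
mulQF : (d : ℤ) → QF d → QF d → QF d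
mulQF d (a , b) (a' , b') =
  (a ℚ.* a' ℚ.+ (d / 1) ℚ.* (b ℚ.* b')) , (a ℚ.* b' ℚ.+ a' ℚ.* b)

addQF : (d : ℤ) → QF d → QF d → QF d
addQF d (a , b) (a' , b') = (a ℚ.+ a') , (b ℚ.+ b')

f : (d : ℤ) → QF d → QF d → QF d
f d c z = addQF d (mulQF d z z) c

iter : ∀ {A : Set} → ℕ → (A → A) → A → A
iter zero g x = x
iter (suc n) g x = g (iter n g x)

Preperiodic : (d : ℤ) → QF d → QF d → Set
Preperiodic d c x = ∃[ m ] ∃[ n ] (m ℕ.< n × iter m (f d c) x ≡ iter n (f d c) x)

next4 : Fin 4 → Fin 4
next4 zero = suc zero
next4 (suc zero) = suc (suc zero)
next4 (suc (suc zero)) = suc (suc (suc zero))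
next4 (suc (suc (suc zero))) = zero

-- G(f_c, ℚ(√d)) contains a subgraph isomorphic to the graph of type 8(4):
-- eight distinct vertices x₁..x₄, y₁..y₄ of G (preperiodic points), with
-- edges xᵢ → xᵢ₊₁ (indices mod 4) and yᵢ → xᵢ.
record Contains8-4 (d : ℤ) (c : QF d) : Set where
  field
    x y : Fin 4 → QF d
    x-inj : ∀ i j → x i ≡ x j → i ≡ j
    y-inj : ∀ i j → y i ≡ y j → i ≡ j
    xy-distinct : ∀ i j → x i ≢ y j
    x-preper : ∀ i → Preperiodic d c (x i)
    y-preper : ∀ i → Preperiodic d c (y i)
    x-edge : ∀ i → f d c (x i) ≡ x (next4 i)
    y-edge : ∀ i → f d c (y i) ≡ x i

module Submission where

open import Defs

-- For rational c, f_c commutes with the conjugation of ℚ(√d) and is even. If 4tr = 1 and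
-- d b²(4t² − 1) = t + t² + r − r², then for c = −r − t² − d b² the point t + b√d starts the
-- 4-cycle t + b√d ↦ −r + 2tb√d ↦ t − b√d ↦ −r − 2tb√d, and the negatives of the cycle points
-- are the four extra preimages of the graph 8(4). Substituting t = U/V, r = V/4U, b = M/4UG
-- turns the condition into d M² = F(U,V) G(U,V), F = 16U⁴ + 16U³V + 4UV³ − V⁴, G = 4U² − V².
-- On the lines U = −(1 + p), V = 2 + p and V = 2 + 3p, F G equals −p K resp. p K with K prime
-- to p whenever p > 64 is prime, so the squarefree part d of F G is divisible by p. Letting
-- the prime p grow gives infinitely many imaginary resp. real quadratic fields.

module Arithmetic where

  open import Data.List using (List; []; _∷_)
  open import Data.List.Relation.Unary.All using (_∷_)
  open import Data.Nat
  open import Data.Nat.Properties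
  open import Data.Nat.Divisibility
  open import Data.Nat.Induction using (<-rec)
  open import Data.Nat.ListAction using (product)
  open import Data.Nat.Primality
  open import Data.Nat.Primality.Factorisation using (factorise)
  open import Data.Nat.Tactic.RingSolver using (solve-∀)
  open import Data.Product using (_×_; _,_; ∃-syntax)
  open import Data.Sum using (inj₁; inj₂; [_,_]′)
  open import Function using (id; _∘_)
  open import Relation.Nullary using (¬_; Dec; yes; no; contradiction)
  open import Relation.Nullary.Decidable using (_×-dec_)
  open import Relation.Binary.PropositionalEquality

  horner : List ℕ → ℕ → ℕ
  horner [] x = 0
  horner (a ∷ as) x = a + x * horner as x

  horner-≢0 : ∀ {a} as n → a ≢ 0 → horner (a ∷ as) n ≢ 0
  horner-≢0 {a} as n a≢0 = a≢0 ∘ m+n≡0⇒m≡0 a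

  ∣horner⇒∣head : ∀ {a} as n → n ∣ horner (a ∷ as) n → n ∣ a
  ∣horner⇒∣head {a} as n n∣h =
    ∣m+n∣m⇒∣n (subst (n ∣_) (+-comm a (n * horner as n)) n∣h) (m∣m*n (horner as n))

  prime-divisor : ∀ n → .{{NonTrivial n}} → ∃[ p ] Prime p × p ∣ n
  prime-divisor n with factorise n {{nonTrivial⇒nonZero n}}
  ... | record { factors = [] ; isFactorisation = n≡1 } = contradiction n≡1 nonTrivial⇒≢1
  ... | record { factors = p ∷ ps ; isFactorisation = n≡p*ps ; factorsPrime = prime[p] ∷ _ } =
    p , prime[p] , subst (p ∣_) (sym n≡p*ps) (m∣m*n (product ps))

  n∣n! : ∀ n .{{_ : NonZero n}} → n ∣ n !
  n∣n! (suc n) = m∣m*n (n !)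

  prime-above : ∀ n → ∃[ p ] Prime p × n < p
  prime-above n with prime-divisor (n ! + 1) {{n>1⇒nonTrivial (+-monoˡ-< 1 (>-nonZero⁻¹ (n !) {{n !≢0}}))}}
  ... | p , prime[p] , p∣n!+1 with p ≤? n
  ...   | no p≰n = p , prime[p] , ≰⇒> p≰n
  ...   | yes p≤n = contradiction (∣1⇒≡1 (∣m+n∣m⇒∣n p∣n!+1 p∣n!)) (nonTrivial⇒≢1 {{prime⇒nonTrivial prime[p]}})
    where
    p∣n! : p ∣ n !
    p∣n! = ∣-trans (n∣n! p {{prime⇒nonZero prime[p]}}) (m≤n⇒m!∣n! p≤n)

  IsSquareFree : ℕ → Set
  IsSquareFree s = ∀ k → k * k ∣ s → k ≡ 1

  SquareFreeDecomposition : ℕ → Set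
  SquareFreeDecomposition n = ∃[ s ] ∃[ m ] n ≡ s * (m * m) × IsSquareFree s

  HasSquareFactor : ℕ → Set
  HasSquareFactor n = ∃[ k ] k < suc n × (1 < k × k * k ∣ n)

  hasSquareFactor? : ∀ n → Dec (HasSquareFactor n)
  hasSquareFactor? n = anyUpTo? (λ k → 1 <? k ×-dec k * k ∣? n) (suc n)

  ¬hasSquareFactor⇒squareFree : ∀ n .{{_ : NonZero n}} → ¬ HasSquareFactor n → IsSquareFree n
  ¬hasSquareFactor⇒squareFree n _ 0 0∣n = contradiction (0∣⇒≡0 0∣n) (≢-nonZero⁻¹ n)
  ¬hasSquareFactor⇒squareFree n _ 1 _ = refl
  ¬hasSquareFactor⇒squareFree n none k@(suc (suc _)) k*k∣n =
    contradiction (k , s≤s (≤-trans (m≤m*n k k) (∣⇒≤ k*k∣n)) , s≤s (s≤s z≤n) , k*k∣n) none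

  squareFree-decomposition : ∀ n .{{_ : NonZero n}} → SquareFreeDecomposition n
  squareFree-decomposition = <-rec (λ n → .{{NonZero n}} → SquareFreeDecomposition n) step
    where
    step : ∀ n → (∀ {q} → q < n → .{{NonZero q}} → SquareFreeDecomposition q) →
           .{{NonZero n}} → SquareFreeDecomposition n
    step n rec with hasSquareFactor? n
    ... | no none = n , 1 , sym (*-identityʳ n) , ¬hasSquareFactor⇒squareFree n none
    ... | yes (k , _ , 1<k@(s≤s (s≤s _)) , divides q n≡q*k²) = extend (rec q<n)
      where
      instance
        q≢0 : NonZero q
        q≢0 = ≢-nonZero λ q≡0 → ≢-nonZero⁻¹ n (trans n≡q*k² (cong (_* (k * k)) q≡0))
      q<n : q < n
      q<n = subst (q <_) (sym n≡q*k²) (m<m*n q (k * k) (<-≤-trans 1<k (m≤m*n k k)))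
      extend : SquareFreeDecomposition q → SquareFreeDecomposition n
      extend (s , m , q≡s*m² , squareFree[s]) = s , m * k , n≡s*[mk]² , squareFree[s]
        where
        regroup : ∀ s m k → s * (m * m) * (k * k) ≡ s * ((m * k) * (m * k))
        regroup = solve-∀
        n≡s*[mk]² : n ≡ s * ((m * k) * (m * k))
        n≡s*[mk]² = trans n≡q*k² (trans (cong (_* (k * k)) q≡s*m²) (regroup s m k))

  s*m²≡p*K⇒p∣s : ∀ {p K s m} → Prime p → ¬ p ∣ K → s * (m * m) ≡ p * K → p ∣ s
  s*m²≡p*K⇒p∣s {p} {K} {s} {m} prime[p] p∤K s*m²≡p*K
    with euclidsLemma s (m * m) prime[p] (subst (p ∣_) (sym s*m²≡p*K) (m∣m*n K))
  ... | inj₁ p∣s = p∣s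
  ... | inj₂ p∣m*m = contradiction (*-cancelˡ-∣ p p*p∣p*K) p∤K
    where
    instance _ = prime⇒nonZero prime[p]
    p∣m : p ∣ m
    p∣m = [ id , id ]′ (euclidsLemma m m prime[p] p∣m*m)
    p*p∣p*K : p * p ∣ p * K
    p*p∣p*K = subst (p * p ∣_) s*m²≡p*K (∣n⇒∣m*n s (*-pres-∣ p∣m p∣m))

module Construction where

  open Arithmetic
  open import Algebra.Properties.Group using (⁻¹-involutive)
  open import Data.Fin using (Fin)
  open import Data.Fin.Patterns using (0F; 1F; 2F; 3F)
  open import Data.Integer as ℤ using (ℤ; +_)
  import Data.Integer.Properties as ℤ
  open import Data.List using (List; []; _∷_)
  open import Data.Nat as ℕ using (ℕ; zero; suc; s≤s; z≤n; _<_; _≤_; NonZero)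
  import Data.Nat.Properties as ℕ
  open import Data.Nat.Divisibility using (_∣_; ∣⇒≤; _∣0)
  open import Data.Nat.Primality using (Prime; prime⇒nonZero; euclidsLemma)
  open import Data.Product using (_×_; _,_; proj₁; proj₂; ∃-syntax)
  open import Data.Rational
    using (ℚ; 0ℚ; 1ℚ; ½; _+_; _*_; -_; _-_; _/_; 1/_; toℚᵘ; ≢-nonZero; NonNegative; nonNegative; nonPositive)
  open import Data.Rational.Properties
    using (_≟_; +-*-commutativeRing; +-0-group; 1≢0; neg-injective; +-inverseʳ; *-assoc; *-identityˡ;
           *-identityʳ; *-zeroˡ; *-zeroʳ; *-inverseʳ; ≤-total; <-irrefl; positive⁻¹; nonNeg+pos⇒pos;
           nonNeg*nonNeg⇒nonNeg; nonPos*nonPos⇒nonPos; toℚᵘ-injective; toℚᵘ-fromℚᵘ; toℚᵘ-cong;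
           toℚᵘ-homo-+; toℚᵘ-homo-*)
  open import Data.Rational.Unnormalised as ℚᵘ using (mkℚᵘ; *≡*)
  import Data.Rational.Unnormalised.Properties as ℚᵘ
  open import Data.Sum using (_⊎_; inj₁; inj₂)
  open import Function using (_∘_)
  open import Level using (0ℓ)
  open import Relation.Nullary using (¬_; contradiction)
  open import Relation.Nullary.Decidable using (dec⇒maybe)
  open import Relation.Binary.PropositionalEquality
  open import Tactic.RingSolver using (solve-∀)
  open import Tactic.RingSolver.Core.AlmostCommutativeRing using (AlmostCommutativeRing; fromCommutativeRing)

  neg-involutive : ∀ q → - - q ≡ q
  neg-involutive = ⁻¹-involutive +-0-group

  ℚ-ring : AlmostCommutativeRing 0ℓ 0ℓ
  ℚ-ring = fromCommutativeRing +-*-commutativeRing (λ x → dec⇒maybe (0ℚ ≟ x))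

  four sixteen ¼ : ℚ
  four = + 4 / 1
  sixteen = + 16 / 1
  ¼ = + 1 / 4

  fromℕ : ℕ → ℚ
  fromℕ n = + n / 1

  toℚᵘ-fromℕ : ∀ n → toℚᵘ (fromℕ n) ℚᵘ.≃ mkℚᵘ (+ n) 0
  toℚᵘ-fromℕ n = toℚᵘ-fromℚᵘ (mkℚᵘ (+ n) 0)

  fromℕ-homo-+ : ∀ m n → fromℕ (m ℕ.+ n) ≡ fromℕ m + fromℕ n
  fromℕ-homo-+ m n = toℚᵘ-injective (begin
    toℚᵘ (fromℕ (m ℕ.+ n))              ≈⟨ toℚᵘ-fromℕ (m ℕ.+ n) ⟩
    mkℚᵘ (+ (m ℕ.+ n)) 0                ≈⟨ *≡* (cong (ℤ._* + 1) numerators) ⟩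
    mkℚᵘ (+ m) 0 ℚᵘ.+ mkℚᵘ (+ n) 0      ≈⟨ ℚᵘ.+-cong (toℚᵘ-fromℕ m) (toℚᵘ-fromℕ n) ⟨
    toℚᵘ (fromℕ m) ℚᵘ.+ toℚᵘ (fromℕ n)  ≈⟨ toℚᵘ-homo-+ (fromℕ m) (fromℕ n) ⟨
    toℚᵘ (fromℕ m + fromℕ n)            ∎)
    where
    open ℚᵘ.≃-Reasoning
    numerators : + (m ℕ.+ n) ≡ + m ℤ.* + 1 ℤ.+ + n ℤ.* + 1
    numerators = trans (ℤ.pos-+ m n) (sym (cong₂ ℤ._+_ (ℤ.*-identityʳ (+ m)) (ℤ.*-identityʳ (+ n))))

  fromℕ-homo-* : ∀ m n → fromℕ (m ℕ.* n) ≡ fromℕ m * fromℕ n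
  fromℕ-homo-* m n = toℚᵘ-injective (begin
    toℚᵘ (fromℕ (m ℕ.* n))              ≈⟨ toℚᵘ-fromℕ (m ℕ.* n) ⟩
    mkℚᵘ (+ (m ℕ.* n)) 0                ≈⟨ *≡* (cong (ℤ._* + 1) (ℤ.pos-* m n)) ⟩
    mkℚᵘ (+ m) 0 ℚᵘ.* mkℚᵘ (+ n) 0      ≈⟨ ℚᵘ.*-cong (toℚᵘ-fromℕ m) (toℚᵘ-fromℕ n) ⟨
    toℚᵘ (fromℕ m) ℚᵘ.* toℚᵘ (fromℕ n)  ≈⟨ toℚᵘ-homo-* (fromℕ m) (fromℕ n) ⟨
    toℚᵘ (fromℕ m * fromℕ n)            ∎)
    where open ℚᵘ.≃-Reasoning

  fromℕ-injective : ∀ {m n} → fromℕ m ≡ fromℕ n → m ≡ n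
  fromℕ-injective {m} {n} eq with ℚᵘ.≃-trans (ℚᵘ.≃-sym (toℚᵘ-fromℕ m)) (ℚᵘ.≃-trans (toℚᵘ-cong eq) (toℚᵘ-fromℕ n))
  ... | *≡* m*1≡n*1 = ℤ.+-injective (trans (sym (ℤ.*-identityʳ (+ m))) (trans m*1≡n*1 (ℤ.*-identityʳ (+ n))))

  fromℕ-≢0 : ∀ {n} → n ≢ 0 → fromℕ n ≢ 0ℚ
  fromℕ-≢0 n≢0 = n≢0 ∘ fromℕ-injective

  hornerℚ : List ℕ → ℚ → ℚ
  hornerℚ [] x = 0ℚ
  hornerℚ (a ∷ as) x = fromℕ a + x * hornerℚ as x

  fromℕ-horner : ∀ as n → fromℕ (horner as n) ≡ hornerℚ as (fromℕ n)
  fromℕ-horner [] n = refl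
  fromℕ-horner (a ∷ as) n = begin
    fromℕ (a ℕ.+ n ℕ.* horner as n)           ≡⟨ fromℕ-homo-+ a (n ℕ.* horner as n) ⟩
    fromℕ a + fromℕ (n ℕ.* horner as n)       ≡⟨ cong (_+_ (fromℕ a)) (fromℕ-homo-* n (horner as n)) ⟩
    fromℕ a + fromℕ n * fromℕ (horner as n)   ≡⟨ cong (λ h → fromℕ a + fromℕ n * h) (fromℕ-horner as n) ⟩
    fromℕ a + fromℕ n * hornerℚ as (fromℕ n)  ∎
    where open ≡-Reasoning

  square-nonNeg : ∀ q → NonNegative (q * q)
  square-nonNeg q with ≤-total 0ℚ q
  ... | inj₁ 0≤q = nonNeg*nonNeg⇒nonNeg q {{nonNegative 0≤q}} q {{nonNegative 0≤q}}
  ... | inj₂ q≤0 = nonPos*nonPos⇒nonPos q {{nonPositive q≤0}} q {{nonPositive q≤0}}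

  square+1≢0 : ∀ q → q * q + 1ℚ ≢ 0ℚ
  square+1≢0 q eq = <-irrefl (sym eq) (positive⁻¹ (q * q + 1ℚ) {{nonNeg+pos⇒pos (q * q) {{square-nonNeg q}} 1ℚ}})

  conjugate : ℚ × ℚ → ℚ × ℚ
  conjugate (a , b) = a , - b

  negate : ℚ × ℚ → ℚ × ℚ
  negate (a , b) = - a , - b

  conjugate-involutive : ∀ z → conjugate (conjugate z) ≡ z
  conjugate-involutive (a , b) = cong (a ,_) (neg-involutive b)

  negate-injective : ∀ {z z′} → negate z ≡ negate z′ → z ≡ z′
  negate-injective {_ , _} {_ , _} e =
    cong₂ _,_ (neg-injective (cong proj₁ e)) (neg-injective (cong proj₂ e))

  f-conjugate : ∀ d c₀ z → f d (c₀ , 0ℚ) (conjugate z) ≡ conjugate (f d (c₀ , 0ℚ) z)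
  f-conjugate d c₀ (a , b) = cong₂ _,_ (real-part (d / 1) a b c₀) (imaginary-part a b)
    where
    real-part : ∀ δ a b c₀ → a * a + δ * (- b * - b) + c₀ ≡ a * a + δ * (b * b) + c₀
    real-part = solve-∀ ℚ-ring
    imaginary-part : ∀ a b → a * - b + a * - b + 0ℚ ≡ - (a * b + a * b + 0ℚ)
    imaginary-part = solve-∀ ℚ-ring

  f-negate : ∀ d c z → f d c (negate z) ≡ f d c z
  f-negate d (c₀ , c₁) (a , b) = cong₂ _,_ (real-part (d / 1) a b c₀) (imaginary-part a b c₁)
    where
    real-part : ∀ δ a b c₀ → - a * - a + δ * (- b * - b) + c₀ ≡ a * a + δ * (b * b) + c₀
    real-part = solve-∀ ℚ-ring
    imaginary-part : ∀ a b c₁ → - a * - b + - a * - b + c₁ ≡ a * b + a * b + c₁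
    imaginary-part = solve-∀ ℚ-ring

  iter-suc : ∀ {A : Set} (g : A → A) n x → iter n g (g x) ≡ iter (suc n) g x
  iter-suc g zero x = refl
  iter-suc g (suc n) x = cong g (iter-suc g n x)

  iter-semiconj : ∀ {A B : Set} {g : A → A} {h : B → B} (x : B → A) →
    (∀ i → g (x i) ≡ x (h i)) → ∀ n i → iter n g (x i) ≡ x (iter n h i)
  iter-semiconj x edge zero i = refl
  iter-semiconj {g = g} {h} x edge (suc n) i = begin
    g (iter n g (x i))  ≡⟨ cong g (iter-semiconj x edge n i) ⟩
    g (x (iter n h i))  ≡⟨ edge (iter n h i) ⟩
    x (h (iter n h i))  ∎
    where open ≡-Reasoning

  periodic⇒preperiodic : ∀ d c {x} n → iter (suc n) (f d c) x ≡ x → Preperiodic d c x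
  periodic⇒preperiodic d c n eq = 0 , suc n , s≤s z≤n , sym eq

  preperiodic-preimage : ∀ d c {x} → Preperiodic d c (f d c x) → Preperiodic d c x
  preperiodic-preimage d c {x} (m , n , m<n , eq) =
    suc m , suc n , s≤s m<n , trans (sym (iter-suc (f d c) m x)) (trans eq (iter-suc (f d c) n x))

  prev4 : Fin 4 → Fin 4
  prev4 = next4 ∘ next4 ∘ next4

  next4-prev4 : ∀ i → next4 (prev4 i) ≡ i
  next4-prev4 0F = refl
  next4-prev4 1F = refl
  next4-prev4 2F = refl
  next4-prev4 3F = refl

  ≢-neg : ∀ {q} → q ≢ 0ℚ → q ≢ - q
  ≢-neg {q} q≢0 q≡-q = q≢0 (begin
    q               ≡⟨ half-double q ⟩
    ½ * (q + q)     ≡⟨ cong (λ y → ½ * (q + y)) q≡-q ⟩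
    ½ * (q + - q)   ≡⟨ cong (½ *_) (+-inverseʳ q) ⟩
    0ℚ              ∎)
    where
    open ≡-Reasoning
    half-double : ∀ q → q ≡ ½ * (q + q)
    half-double = solve-∀ ℚ-ring

  -- The graph 8(4) from a rational 4-cycle

  module FourCycle (d : ℤ) {t r b : ℚ} (4tr≡1 : four * t * r ≡ 1ℚ)
    (cycle-condition : (d / 1) * (b * b) * (four * t * t - 1ℚ) ≡ t + t * t + r - r * r)
    (t≢r : t ≢ r) (b≢0 : b ≢ 0ℚ) where

    c : QF d
    c = - r - t * t - (d / 1) * (b * b) , 0ℚ

    w : ℚ
    w = t * b + t * b

    X : Fin 4 → QF d
    X 0F = t , b
    X 1F = - r , w
    X 2F = conjugate (X 0F)
    X 3F = conjugate (X 1F)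

    Y : Fin 4 → QF d
    Y i = negate (X (prev4 i))

    f-X₀ : f d c (X 0F) ≡ X 1F
    f-X₀ = cong₂ _,_ (real-part (d / 1) t b r) (imaginary-part t b)
      where
      real-part : ∀ δ t b r → t * t + δ * (b * b) + (- r - t * t - δ * (b * b)) ≡ - r
      real-part = solve-∀ ℚ-ring
      imaginary-part : ∀ t b → t * b + t * b + 0ℚ ≡ t * b + t * b
      imaginary-part = solve-∀ ℚ-ring

    f-X₁ : f d c (X 1F) ≡ X 2F
    f-X₁ = cong₂ _,_ real-part imaginary-part
      where
      open ≡-Reasoning
      δ = d / 1
      real-part : - r * - r + δ * (w * w) + (- r - t * t - δ * (b * b)) ≡ t
      real-part = begin
        - r * - r + δ * (w * w) + (- r - t * t - δ * (b * b))
          ≡⟨ expand δ t r b ⟩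
        δ * (b * b) * (four * t * t - 1ℚ) - (t + t * t + r - r * r) + t
          ≡⟨ cong (λ e → e - (t + t * t + r - r * r) + t) cycle-condition ⟩
        (t + t * t + r - r * r) - (t + t * t + r - r * r) + t
          ≡⟨ cancel (t + t * t + r - r * r) t ⟩
        t ∎
        where
        expand : ∀ δ t r b → - r * - r + δ * ((t * b + t * b) * (t * b + t * b)) + (- r - t * t - δ * (b * b))
                           ≡ δ * (b * b) * (four * t * t - 1ℚ) - (t + t * t + r - r * r) + t
        expand = solve-∀ ℚ-ring
        cancel : ∀ e t → e - e + t ≡ t
        cancel = solve-∀ ℚ-ring
      imaginary-part : - r * w + - r * w + 0ℚ ≡ - b
      imaginary-part = begin
        - r * w + - r * w + 0ℚ  ≡⟨ expand t r b ⟩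
        - (four * t * r * b)    ≡⟨ cong (λ e → - (e * b)) 4tr≡1 ⟩
        - (1ℚ * b)              ≡⟨ cong -_ (*-identityˡ b) ⟩
        - b ∎
        where
        expand : ∀ t r b → - r * (t * b + t * b) + - r * (t * b + t * b) + 0ℚ ≡ - (four * t * r * b)
        expand = solve-∀ ℚ-ring

    X-edge : ∀ i → f d c (X i) ≡ X (next4 i)
    X-edge 0F = f-X₀
    X-edge 1F = f-X₁
    X-edge 2F = trans (f-conjugate d _ (X 0F)) (cong conjugate f-X₀)
    X-edge 3F = trans (f-conjugate d _ (X 1F)) (trans (cong conjugate f-X₁) (conjugate-involutive (X 0F)))

    Y-edge : ∀ i → f d c (Y i) ≡ X i
    Y-edge i = trans (f-negate d c (X (prev4 i))) (trans (X-edge (prev4 i)) (cong X (next4-prev4 i)))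

    X-periodic : ∀ i → iter 4 (f d c) (X i) ≡ X i
    X-periodic i = trans (iter-semiconj {g = f d c} {h = next4} X X-edge 4 i) (cong X (next4-period i))
      where
      next4-period : ∀ i → iter 4 next4 i ≡ i
      next4-period 0F = refl
      next4-period 1F = refl
      next4-period 2F = refl
      next4-period 3F = refl

    t≢0 : t ≢ 0ℚ
    t≢0 t≡0 = 1≢0 (trans (sym 4tr≡1) (trans (cong (λ t → four * t * r) t≡0) (annihilate r)))
      where
      annihilate : ∀ r → four * 0ℚ * r ≡ 0ℚ
      annihilate = solve-∀ ℚ-ring

    r≢0 : r ≢ 0ℚ
    r≢0 r≡0 = 1≢0 (trans (sym 4tr≡1) (trans (cong (four * t *_) r≡0) (annihilate t)))
      where
      annihilate : ∀ t → four * t * 0ℚ ≡ 0ℚ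
      annihilate = solve-∀ ℚ-ring

    -- Over ℚ, 4tr = 1 with t = −r would make −(2t)² = 1.
    t≢-r : t ≢ - r
    t≢-r t≡-r = square+1≢0 (t + t) (begin
      (t + t) * (t + t) + 1ℚ                      ≡⟨ cong (_+_ ((t + t) * (t + t))) (sym 4tr≡1) ⟩
      (t + t) * (t + t) + four * t * r            ≡⟨ cong (λ t → (t + t) * (t + t) + four * t * r) t≡-r ⟩
      (- r + - r) * (- r + - r) + four * - r * r  ≡⟨ vanishes r ⟩
      0ℚ                                          ∎)
      where
      open ≡-Reasoning
      vanishes : ∀ r → (- r + - r) * (- r + - r) + four * - r * r ≡ 0ℚ
      vanishes = solve-∀ ℚ-ring

    w≢0 : w ≢ 0ℚ
    w≢0 w≡0 = b≢0 (begin
      b                    ≡⟨ sym (*-identityˡ b) ⟩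
      1ℚ * b               ≡⟨ cong (_* b) (sym 4tr≡1) ⟩
      four * t * r * b     ≡⟨ regroup t r b ⟩
      w * (r + r)          ≡⟨ cong (_* (r + r)) w≡0 ⟩
      0ℚ * (r + r)         ≡⟨ *-zeroˡ (r + r) ⟩
      0ℚ                   ∎)
      where
      open ≡-Reasoning
      regroup : ∀ t r b → four * t * r * b ≡ (t * b + t * b) * (r + r)
      regroup = solve-∀ ℚ-ring

    X-injective : ∀ i j → X i ≡ X j → i ≡ j
    X-injective 0F 0F _ = refl
    X-injective 0F 1F e = contradiction (cong proj₁ e) t≢-r
    X-injective 0F 2F e = contradiction (cong proj₂ e) (≢-neg b≢0)
    X-injective 0F 3F e = contradiction (cong proj₁ e) t≢-r
    X-injective 1F 0F e = contradiction (sym (cong proj₁ e)) t≢-r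
    X-injective 1F 1F _ = refl
    X-injective 1F 2F e = contradiction (sym (cong proj₁ e)) t≢-r
    X-injective 1F 3F e = contradiction (cong proj₂ e) (≢-neg w≢0)
    X-injective 2F 0F e = contradiction (sym (cong proj₂ e)) (≢-neg b≢0)
    X-injective 2F 1F e = contradiction (cong proj₁ e) t≢-r
    X-injective 2F 2F _ = refl
    X-injective 2F 3F e = contradiction (cong proj₁ e) t≢-r
    X-injective 3F 0F e = contradiction (sym (cong proj₁ e)) t≢-r
    X-injective 3F 1F e = contradiction (sym (cong proj₂ e)) (≢-neg w≢0)
    X-injective 3F 2F e = contradiction (sym (cong proj₁ e)) t≢-r
    X-injective 3F 3F _ = refl

    Y-injective : ∀ i j → Y i ≡ Y j → i ≡ j
    Y-injective i j e = begin
      i                ≡⟨ sym (next4-prev4 i) ⟩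
      next4 (prev4 i)  ≡⟨ cong next4 (X-injective (prev4 i) (prev4 j) (negate-injective e)) ⟩
      next4 (prev4 j)  ≡⟨ next4-prev4 j ⟩
      j                ∎
      where open ≡-Reasoning

    X-abscissa : ∀ i → proj₁ (X i) ≡ t ⊎ proj₁ (X i) ≡ - r
    X-abscissa 0F = inj₁ refl
    X-abscissa 1F = inj₂ refl
    X-abscissa 2F = inj₁ refl
    X-abscissa 3F = inj₂ refl

    X≢Y : ∀ i j → X i ≢ Y j
    X≢Y i j e = opposite-abscissae (X-abscissa i) (X-abscissa (prev4 j)) (cong proj₁ e)
      where
      opposite-abscissae : ∀ {u v} → u ≡ t ⊎ u ≡ - r → v ≡ t ⊎ v ≡ - r → u ≢ - v
      opposite-abscissae (inj₁ refl) (inj₁ refl) e = ≢-neg t≢0 e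
      opposite-abscissae (inj₁ refl) (inj₂ refl) e = t≢r (trans e (neg-involutive r))
      opposite-abscissae (inj₂ refl) (inj₁ refl) e = t≢r (sym (neg-injective e))
      opposite-abscissae (inj₂ refl) (inj₂ refl) e = ≢-neg r≢0 (sym (trans e (neg-involutive r)))

    X-preperiodic : ∀ i → Preperiodic d c (X i)
    X-preperiodic i = periodic⇒preperiodic d c 3 (X-periodic i)

    Y-preperiodic : ∀ i → Preperiodic d c (Y i)
    Y-preperiodic i = preperiodic-preimage d c (subst (Preperiodic d c) (sym (Y-edge i)) (X-preperiodic i))

    contains8-4 : ∃[ c ] Contains8-4 d c
    contains8-4 = c , record
      { x = X ; y = Y ; x-inj = X-injective ; y-inj = Y-injective ; xy-distinct = X≢Y
      ; x-preper = X-preperiodic ; y-preper = Y-preperiodic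
      ; x-edge = X-edge ; y-edge = Y-edge }

  -- The curve d M² = F(U,V) G(U,V)

  F : ℚ → ℚ → ℚ
  F U V = sixteen * (U * U * U * U) + sixteen * (U * U * U * V) + four * (U * V * V * V) - V * V * V * V

  G : ℚ → ℚ → ℚ
  G U V = four * (U * U) - V * V

  module Parametrisation (d : ℤ) {U V M : ℚ} (U≢0 : U ≢ 0ℚ) (V≢0 : V ≢ 0ℚ) (G≢0 : G U V ≢ 0ℚ)
    (M≢0 : M ≢ 0ℚ) (on-curve : (d / 1) * (M * M) ≡ F U V * G U V) where

    instance
      _ = ≢-nonZero U≢0
      _ = ≢-nonZero V≢0
      _ = ≢-nonZero G≢0

    U⁻¹ V⁻¹ G⁻¹ : ℚ
    U⁻¹ = 1/ U
    V⁻¹ = 1/ V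
    G⁻¹ = 1/ (G U V)

    t r b : ℚ
    t = U * V⁻¹
    r = V * U⁻¹ * ¼
    b = M * U⁻¹ * G⁻¹ * ¼

    4tr≡1 : four * t * r ≡ 1ℚ
    4tr≡1 = begin
      four * t * r          ≡⟨ regroup U V U⁻¹ V⁻¹ ⟩
      (U * U⁻¹) * (V * V⁻¹) ≡⟨ cong₂ _*_ (*-inverseʳ U) (*-inverseʳ V) ⟩
      1ℚ * 1ℚ               ∎
      where
      open ≡-Reasoning
      regroup : ∀ U V U⁻¹ V⁻¹ → four * (U * V⁻¹) * (V * U⁻¹ * ¼) ≡ (U * U⁻¹) * (V * V⁻¹)
      regroup = solve-∀ ℚ-ring

    4t²-1≡G/V² : four * t * t - 1ℚ ≡ G U V * V⁻¹ * V⁻¹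
    4t²-1≡G/V² = begin
      four * t * t - 1ℚ                       ≡⟨ cong (λ v → four * t * t - v * v) (sym (*-inverseʳ V)) ⟩
      four * t * t - (V * V⁻¹) * (V * V⁻¹)    ≡⟨ regroup U V V⁻¹ ⟩
      G U V * V⁻¹ * V⁻¹                       ∎
      where
      open ≡-Reasoning
      regroup : ∀ U V V⁻¹ → four * (U * V⁻¹) * (U * V⁻¹) - (V * V⁻¹) * (V * V⁻¹) ≡ (four * (U * U) - V * V) * V⁻¹ * V⁻¹
      regroup = solve-∀ ℚ-ring

    -- As 4t² − 1 = G/V², the left side is d M²/(16 U² V² G) = F/(16 U² V²), which is
    -- t² + t + r − r² written with the units U U⁻¹ and V V⁻¹ left in place (P below).
    cycle-condition : (d / 1) * (b * b) * (four * t * t - 1ℚ) ≡ t + t * t + r - r * r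
    cycle-condition = begin
      δ * (b * b) * (four * t * t - 1ℚ)      ≡⟨ cong (δ * (b * b) *_) 4t²-1≡G/V² ⟩
      δ * (b * b) * (Γ * V⁻¹ * V⁻¹)          ≡⟨ collect δ M Γ U⁻¹ V⁻¹ G⁻¹ ⟩
      δ * (M * M) * Γ * D * (G⁻¹ * G⁻¹)      ≡⟨ cong (λ e → e * Γ * D * (G⁻¹ * G⁻¹)) on-curve ⟩
      F U V * Γ * Γ * D * (G⁻¹ * G⁻¹)        ≡⟨ cancel-G (F U V) Γ D G⁻¹ ⟩
      F U V * (Γ * G⁻¹) * (Γ * G⁻¹) * D      ≡⟨ cong (λ g → F U V * g * g * D) (*-inverseʳ Γ) ⟩
      F U V * 1ℚ * 1ℚ * D                    ≡⟨ expand U V U⁻¹ V⁻¹ ⟩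
      P (U * U⁻¹) (V * V⁻¹)                  ≡⟨ cong₂ P (*-inverseʳ U) (*-inverseʳ V) ⟩
      P 1ℚ 1ℚ                                ≡⟨ specialise t r ⟩
      t + t * t + r - r * r                  ∎
      where
      open ≡-Reasoning
      δ = d / 1
      Γ = G U V
      D = U⁻¹ * U⁻¹ * V⁻¹ * V⁻¹ * ¼ * ¼
      P : ℚ → ℚ → ℚ
      P u v = u * u * t * t + u * u * t * v + u * r * v * v - r * r * v * v
      collect : ∀ δ M Γ U⁻¹ V⁻¹ G⁻¹ →
        δ * ((M * U⁻¹ * G⁻¹ * ¼) * (M * U⁻¹ * G⁻¹ * ¼)) * (Γ * V⁻¹ * V⁻¹)
          ≡ δ * (M * M) * Γ * (U⁻¹ * U⁻¹ * V⁻¹ * V⁻¹ * ¼ * ¼) * (G⁻¹ * G⁻¹)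
      collect = solve-∀ ℚ-ring
      cancel-G : ∀ Φ Γ D G⁻¹ → Φ * Γ * Γ * D * (G⁻¹ * G⁻¹) ≡ Φ * (Γ * G⁻¹) * (Γ * G⁻¹) * D
      cancel-G = solve-∀ ℚ-ring
      expand : ∀ U V U⁻¹ V⁻¹ →
        (sixteen * (U * U * U * U) + sixteen * (U * U * U * V) + four * (U * V * V * V) - V * V * V * V)
          * 1ℚ * 1ℚ * (U⁻¹ * U⁻¹ * V⁻¹ * V⁻¹ * ¼ * ¼)
        ≡ (U * U⁻¹) * (U * U⁻¹) * (U * V⁻¹) * (U * V⁻¹) + (U * U⁻¹) * (U * U⁻¹) * (U * V⁻¹) * (V * V⁻¹)
          + (U * U⁻¹) * (V * U⁻¹ * ¼) * (V * V⁻¹) * (V * V⁻¹)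
          - (V * U⁻¹ * ¼) * (V * U⁻¹ * ¼) * (V * V⁻¹) * (V * V⁻¹)
      expand = solve-∀ ℚ-ring
      specialise : ∀ t r → 1ℚ * 1ℚ * t * t + 1ℚ * 1ℚ * t * 1ℚ + 1ℚ * r * 1ℚ * 1ℚ - r * r * 1ℚ * 1ℚ
                           ≡ t + t * t + r - r * r
      specialise = solve-∀ ℚ-ring

    t≢r : t ≢ r
    t≢r t≡r = G≢0 (begin
      Γ                              ≡⟨ sym (*-identityʳ Γ) ⟩
      Γ * (1ℚ * 1ℚ)                  ≡⟨ cong (λ v → Γ * (v * v)) (sym (*-inverseʳ V)) ⟩
      Γ * ((V * V⁻¹) * (V * V⁻¹))    ≡⟨ regroup Γ V V⁻¹ ⟩
      Γ * V⁻¹ * V⁻¹ * (V * V)        ≡⟨ cong (_* (V * V)) (sym 4t²-1≡G/V²) ⟩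
      (four * t * t - 1ℚ) * (V * V)  ≡⟨ cong (λ s → (four * t * s - 1ℚ) * (V * V)) t≡r ⟩
      (four * t * r - 1ℚ) * (V * V)  ≡⟨ cong (λ e → (e - 1ℚ) * (V * V)) 4tr≡1 ⟩
      (1ℚ - 1ℚ) * (V * V)            ≡⟨ vanishes (V * V) ⟩
      0ℚ                             ∎)
      where
      open ≡-Reasoning
      Γ = G U V
      regroup : ∀ Γ V V⁻¹ → Γ * ((V * V⁻¹) * (V * V⁻¹)) ≡ Γ * V⁻¹ * V⁻¹ * (V * V)
      regroup = solve-∀ ℚ-ring
      vanishes : ∀ x → (1ℚ - 1ℚ) * x ≡ 0ℚ
      vanishes = solve-∀ ℚ-ring

    b≢0 : b ≢ 0ℚ
    b≢0 b≡0 = M≢0 (begin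
      M                                      ≡⟨ sym (*-identityʳ M) ⟩
      M * (1ℚ * 1ℚ)                          ≡⟨ cong₂ (λ u g → M * (u * g)) (sym (*-inverseʳ U)) (sym (*-inverseʳ Γ)) ⟩
      M * ((U * U⁻¹) * (Γ * G⁻¹))            ≡⟨ regroup M U Γ U⁻¹ G⁻¹ ⟩
      (M * U⁻¹ * G⁻¹ * ¼) * (four * U * Γ)   ≡⟨ cong (_* (four * U * Γ)) b≡0 ⟩
      0ℚ * (four * U * Γ)                    ≡⟨ *-zeroˡ (four * U * Γ) ⟩
      0ℚ                                     ∎)
      where
      open ≡-Reasoning
      Γ = G U V
      regroup : ∀ M U Γ U⁻¹ G⁻¹ → M * ((U * U⁻¹) * (Γ * G⁻¹)) ≡ (M * U⁻¹ * G⁻¹ * ¼) * (four * U * Γ)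
      regroup = solve-∀ ℚ-ring

    contains8-4 : ∃[ c ] Contains8-4 d c
    contains8-4 = FourCycle.contains8-4 d 4tr≡1 cycle-condition t≢r b≢0

  -- Squarefree parts along two lines

  Carries8-4 : ℚ → ℕ → Set
  Carries8-4 ε s = IsSquareFree s × ∀ d → d / 1 ≡ ε * fromℕ s → ∃[ c ] Contains8-4 d c

  carries8-4-squareFree-part : ∀ (ε : ℚ) {U V p K} → U ≢ 0ℚ → V ≢ 0ℚ → G U V ≢ 0ℚ →
    Prime p → ¬ p ∣ K → F U V * G U V ≡ ε * fromℕ (p ℕ.* K) → ∃[ s ] (p ≤ s × Carries8-4 ε s)
  carries8-4-squareFree-part ε {U} {V} {p} {K} U≢0 V≢0 G≢0 prime[p] p∤K FG≡εpK =
    decompose (squareFree-decomposition (p ℕ.* K))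
    where
    instance
      _ = prime⇒nonZero prime[p]
      _ = ℕ.≢-nonZero λ K≡0 → p∤K (subst (p ∣_) (sym K≡0) (p ∣0))
      pK≢0 = ℕ.m*n≢0 p K
    decompose : SquareFreeDecomposition (p ℕ.* K) → ∃[ s ] (p ≤ s × Carries8-4 ε s)
    decompose (s , m , pK≡s*m² , squareFree[s]) = s , ∣⇒≤ p∣s , squareFree[s] , on-curve
      where
      instance
        sm²≢0 = subst NonZero pK≡s*m² pK≢0
        _ = ℕ.m*n≢0⇒m≢0 s
        _ = ℕ.m*n≢0⇒m≢0 m {{ℕ.m*n≢0⇒n≢0 s {m ℕ.* m}}}
      p∣s : p ∣ s
      p∣s = s*m²≡p*K⇒p∣s {m = m} prime[p] p∤K (sym pK≡s*m²)
      on-curve : ∀ d → d / 1 ≡ ε * fromℕ s → ∃[ c ] Contains8-4 d c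
      on-curve d d≡εs = Parametrisation.contains8-4 d U≢0 V≢0 G≢0 (fromℕ-≢0 (ℕ.≢-nonZero⁻¹ m)) (begin
        d / 1 * (fromℕ m * fromℕ m)         ≡⟨ cong (_* (fromℕ m * fromℕ m)) d≡εs ⟩
        ε * fromℕ s * (fromℕ m * fromℕ m)   ≡⟨ *-assoc ε (fromℕ s) (fromℕ m * fromℕ m) ⟩
        ε * (fromℕ s * (fromℕ m * fromℕ m)) ≡⟨ cong (λ q → ε * (fromℕ s * q)) (fromℕ-homo-* m m) ⟨
        ε * (fromℕ s * fromℕ (m ℕ.* m))     ≡⟨ cong (ε *_) (fromℕ-homo-* s (m ℕ.* m)) ⟨
        ε * fromℕ (s ℕ.* (m ℕ.* m))         ≡⟨ cong (λ n → ε * fromℕ n) pK≡s*m² ⟨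
        ε * fromℕ (p ℕ.* K)                 ≡⟨ FG≡εpK ⟨
        F U V * G U V                       ∎)
        where open ≡-Reasoning

  module LinearFamily (k : ℕ) (ε : ℚ) (ε*ε≡1 : ε * ε ≡ 1ℚ) (Bs Cs : List ℕ)
    (F-on-line : ∀ x → F (- (1ℚ + x)) (fromℕ 2 + fromℕ k * x) ≡ - hornerℚ (64 ∷ Bs) x)
    (G-on-line : ∀ x → G (- (1ℚ + x)) (fromℕ 2 + fromℕ k * x) ≡ - ε * (x * hornerℚ (4 ∷ Cs) x))
    where

    module _ {p : ℕ} (prime[p] : Prime p) (64<p : 64 < p) where

      private
        x = fromℕ p
        U = - (1ℚ + x)
        V = fromℕ 2 + fromℕ k * x
        B = horner (64 ∷ Bs) p
        C = horner (4 ∷ Cs) p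

      U≢0 : U ≢ 0ℚ
      U≢0 U≡0 = fromℕ-≢0 {1 ℕ.+ p} (λ ()) (trans (fromℕ-homo-+ 1 p) (neg-injective U≡0))

      V≢0 : V ≢ 0ℚ
      V≢0 V≡0 = fromℕ-≢0 {2 ℕ.+ k ℕ.* p} (λ ())
        (trans (fromℕ-homo-+ 2 (k ℕ.* p)) (trans (cong (_+_ (fromℕ 2)) (fromℕ-homo-* k p)) V≡0))

      G≢0 : G U V ≢ 0ℚ
      G≢0 G≡0 = fromℕ-≢0 pC≢0 (begin
        fromℕ (p ℕ.* C)          ≡⟨ trans (fromℕ-homo-* p C) (cong (x *_) (fromℕ-horner (4 ∷ Cs) p)) ⟩
        xC                       ≡⟨ *-identityˡ xC ⟨
        1ℚ * xC                  ≡⟨ cong (_* xC) ε*ε≡1 ⟨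
        ε * ε * xC               ≡⟨ double-negation ε xC ⟩
        - ε * (- ε * xC)         ≡⟨ cong (- ε *_) (trans (sym (G-on-line x)) G≡0) ⟩
        - ε * 0ℚ                 ≡⟨ *-zeroʳ (- ε) ⟩
        0ℚ                       ∎)
        where
        open ≡-Reasoning
        xC = x * hornerℚ (4 ∷ Cs) x
        pC≢0 : p ℕ.* C ≢ 0
        pC≢0 pC≡0 with ℕ.m*n≡0⇒m≡0∨n≡0 p pC≡0
        ... | inj₁ p≡0 = ℕ.≢-nonZero⁻¹ p {{prime⇒nonZero prime[p]}} p≡0
        ... | inj₂ C≡0 = horner-≢0 Cs p (λ ()) C≡0
        double-negation : ∀ ε y → ε * ε * y ≡ - ε * (- ε * y)
        double-negation = solve-∀ ℚ-ring

      p∤BC : ¬ p ∣ B ℕ.* C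
      p∤BC p∣BC with euclidsLemma B C prime[p] p∣BC
      ... | inj₁ p∣B = ℕ.<⇒≱ 64<p (∣⇒≤ (∣horner⇒∣head Bs p p∣B))
      ... | inj₂ p∣C = ℕ.<⇒≱ (ℕ.≤-<-trans (ℕ.m≤m+n 4 60) 64<p) (∣⇒≤ (∣horner⇒∣head Cs p p∣C))

      FG≡εpBC : F U V * G U V ≡ ε * fromℕ (p ℕ.* (B ℕ.* C))
      FG≡εpBC = begin
        F U V * G U V                   ≡⟨ cong₂ _*_ (F-on-line x) (G-on-line x) ⟩
        - hB * (- ε * (x * hC))         ≡⟨ regroup hB hC ε x ⟩
        ε * (x * (hB * hC))             ≡⟨ cong (λ e → ε * (x * e)) (cong₂ _*_ (fromℕ-horner (64 ∷ Bs) p) (fromℕ-horner (4 ∷ Cs) p)) ⟨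
        ε * (x * (fromℕ B * fromℕ C))   ≡⟨ cong (λ e → ε * (x * e)) (fromℕ-homo-* B C) ⟨
        ε * (x * fromℕ (B ℕ.* C))       ≡⟨ cong (ε *_) (fromℕ-homo-* p (B ℕ.* C)) ⟨
        ε * fromℕ (p ℕ.* (B ℕ.* C))     ∎
        where
        open ≡-Reasoning
        hB = hornerℚ (64 ∷ Bs) x
        hC = hornerℚ (4 ∷ Cs) x
        regroup : ∀ hB hC ε x → - hB * (- ε * (x * hC)) ≡ ε * (x * (hB * hC))
        regroup = solve-∀ ℚ-ring

      carries8-4-at-prime : ∃[ s ] (p ≤ s × Carries8-4 ε s)
      carries8-4-at-prime = carries8-4-squareFree-part ε U≢0 V≢0 G≢0 prime[p] p∤BC FG≡εpBC

    carries8-4-beyond : ∀ N → ∃[ s ] (N < s × 1 < s × Carries8-4 ε s)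
    carries8-4-beyond N = from-prime (prime-above (64 ℕ.+ N))
      where
      from-prime : ∃[ p ] Prime p × 64 ℕ.+ N < p → ∃[ s ] (N < s × 1 < s × Carries8-4 ε s)
      from-prime (p , prime[p] , 64+N<p) = from-s (carries8-4-at-prime prime[p] (ℕ.m+n≤o⇒m≤o 65 64+N<p))
        where
        from-s : ∃[ s ] (p ≤ s × Carries8-4 ε s) → ∃[ s ] (N < s × 1 < s × Carries8-4 ε s)
        from-s (s , p≤s , carries) =
          s , ℕ.<-≤-trans (ℕ.m+n≤o⇒n≤o 64 64+N<p) p≤s , ℕ.<-≤-trans (ℕ.m+n≤o⇒m≤o 2 64+N<p) p≤s , carries

  -- The ring solver does not unfold F, G or hornerℚ, so the identities below are written out.
  imaginary-family : ∀ N → ∃[ s ] (N < s × 1 < s × Carries8-4 (- 1ℚ) s)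
  imaginary-family = LinearFamily.carries8-4-beyond 1 (- 1ℚ) refl
    (160 ∷ 144 ∷ 52 ∷ 5 ∷ []) (3 ∷ []) F-on-line G-on-line
    where
    F-on-line : ∀ x → let U = - (1ℚ + x); V = fromℕ 2 + fromℕ 1 * x in
      sixteen * (U * U * U * U) + sixteen * (U * U * U * V) + four * (U * V * V * V) - V * V * V * V
        ≡ - (fromℕ 64 + x * (fromℕ 160 + x * (fromℕ 144 + x * (fromℕ 52 + x * (fromℕ 5 + x * 0ℚ)))))
    F-on-line = solve-∀ ℚ-ring
    G-on-line : ∀ x → let U = - (1ℚ + x); V = fromℕ 2 + fromℕ 1 * x in
      four * (U * U) - V * V ≡ - (- 1ℚ) * (x * (fromℕ 4 + x * (fromℕ 3 + x * 0ℚ)))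
    G-on-line = solve-∀ ℚ-ring

  real-family : ∀ N → ∃[ s ] (N < s × 1 < s × Carries8-4 1ℚ s)
  real-family = LinearFamily.carries8-4-beyond 3 1ℚ refl
    (352 ∷ 720 ∷ 652 ∷ 221 ∷ []) (5 ∷ []) F-on-line G-on-line
    where
    F-on-line : ∀ x → let U = - (1ℚ + x); V = fromℕ 2 + fromℕ 3 * x in
      sixteen * (U * U * U * U) + sixteen * (U * U * U * V) + four * (U * V * V * V) - V * V * V * V
        ≡ - (fromℕ 64 + x * (fromℕ 352 + x * (fromℕ 720 + x * (fromℕ 652 + x * (fromℕ 221 + x * 0ℚ)))))
    F-on-line = solve-∀ ℚ-ring
    G-on-line : ∀ x → let U = - (1ℚ + x); V = fromℕ 2 + fromℕ 3 * x in
      four * (U * U) - V * V ≡ - 1ℚ * (x * (fromℕ 4 + x * (fromℕ 5 + x * 0ℚ)))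
    G-on-line = solve-∀ ℚ-ring

  -1*q≡-q : ∀ q → - 1ℚ * q ≡ - q
  -1*q≡-q = solve-∀ ℚ-ring

open Construction using (Carries8-4; real-family; imaginary-family; -1*q≡-q)
open import Data.Integer using (ℤ; +_; -_; _<_; _>_)
open import Data.Nat using (ℕ)
open import Data.Product using (_×_; ∃-syntax)
open import Data.Integer using (-[1+_]; +<+; -<+)
open import Data.Integer.Properties using (neg-mono-<)
import Data.Nat as ℕ
open import Data.Nat using (suc)
open import Data.Product using (_,_)
import Data.Rational as ℚ
open import Data.Rational using (1ℚ)
open import Data.Rational.Properties using (*-identityˡ)
open import Relation.Binary.PropositionalEquality using (sym)

real-quadratic-fields : (N : ℕ) → ∃[ d ] (d > + N × + 1 < d × SquareFree d × ∃[ c ] Contains8-4 d c)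
real-quadratic-fields N = realise (real-family N)
  where
  realise : ∃[ s ] (N ℕ.< s × 1 ℕ.< s × Carries8-4 1ℚ s) →
            ∃[ d ] (d > + N × + 1 < d × SquareFree d × ∃[ c ] Contains8-4 d c)
  realise (suc s , N<s , 1<s , squareFree[s] , carries) =
    + suc s , +<+ N<s , +<+ 1<s , ((λ ()) , squareFree[s]) , carries (+ suc s) (sym (*-identityˡ _))

imaginary-quadratic-fields : (N : ℕ) → ∃[ d ] (d < - (+ N) × d < + 0 × SquareFree d × ∃[ c ] Contains8-4 d c)
imaginary-quadratic-fields N = realise (imaginary-family N)
  where
  realise : ∃[ s ] (N ℕ.< s × 1 ℕ.< s × Carries8-4 (ℚ.- 1ℚ) s) →
            ∃[ d ] (d < - (+ N) × d < + 0 × SquareFree d × ∃[ c ] Contains8-4 d c)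
  -- -[1+ s ] / 1 computes to - fromℕ (suc s).
  realise (suc s , N<s , _ , squareFree[s] , carries) =
    -[1+ s ] , neg-mono-< (+<+ N<s) , -<+ , ((λ ()) , squareFree[s]) , carries -[1+ s ] (sym (-1*q≡-q _))

proposition3p21 : ((N : ℕ) → ∃[ d ] (d > + N × + 1 < d × SquareFree d × ∃[ c ] Contains8-4 d c))
    × ((N : ℕ) → ∃[ d ] (d < - (+ N) × d < + 0 × SquareFree d × ∃[ c ] Contains8-4 d c))
proposition3p21 = real-quadratic-fields , imaginary-quadratic-fields
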